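{- Let $k>3$ and $n\ge 1$ be integers, let $\mathcal D_n=\{e_0,e_1,\ldots,e_n\}\subseteq(C_k)^n$ be the canonical set, and let $\mathfrak M=\mathbf D((C_k)^n,\mathcal D_n)$, $o=(0,\ldots,0)$. Then the stabilizer of the point $o$ in $\mathrm{Aut}(\mathfrak M)$ is isomorphic to the symmetric group $S_{n+1}$, and $\mathrm{Aut}(\mathfrak M)\cong S_{n+1}\ltimes(C_k)^n$, the semidirect product of the normal subgroup of translations $x\mapsto x+v$ ($v\in(C_k)^n$) by this stabilizer.
   Context: $C_k$ is the cyclic group $\mathbb Z/k\mathbb Z$; $(C_k)^n$ is written additively. $e_0=(0,\ldots,0)$ and $e_i$ ($1\le i\le n$) is the vector with $1$ in coordinate $i$ and $0$ elsewhere; $\mathcal D_n=\{e_0,\ldots,e_n\}$. For an abelian group $\mathsf G$ and $D\subseteq G$, $\mathbf D(\mathsf G,D)$ is the incidence structure whose points are the elements of $G$ and whose lines are the translates $b+D$, $b\in G$, incidence being membership. An automorphism is a pair of bijections (of points and of lines) preserving and reflecting incidence. The stabilizer is isomorphic to $S_{n+1}$ via the action on the $n+1$ lines $-e_0+\mathcal D_n,\ldots,-e_n+\mathcal D_n$ through $o$; it is generated by the group automorphisms permuting coordinates and the maps $x\mapsto(x_1,\ldots,x_{s-1},-\sum_{i=1}^n x_i,x_{s+1},\ldots,x_n)$, and conjugation acts on translations by $f\tau_vf^{ -1}=\tau_{f(v)}$. -}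

module Defs where

open import Data.Nat.Base using (ℕ; NonZero)
open import Data.Nat.DivMod using (_mod_)
open import Data.Fin.Base using (Fin; toℕ; zero; suc)
open import Data.Vec.Base using (Vec; zipWith; replicate; _[_]≔_)
open import Data.Product.Base using (Σ; ∃; _×_; _,_; proj₁)
open import Data.Fin.Permutation using (Permutation′; _⟨$⟩ʳ_)
open import Function.Bundles using (_↔_; _⇔_; Inverse; Equivalence; mk⇔)
open import Function.Construct.Composition using (_↔-∘_; _⇔-∘_)
open import Function.Construct.Identity using (↔-id; ⇔-id)
open import Function.Construct.Symmetry using (↔-sym; ⇔-sym)
open import Relation.Binary.PropositionalEquality using (_≡_; refl; sym; trans; cong; subst; subst₂)

_+ₖ_ : ∀ {k} .{{_ : NonZero k}} → Fin k → Fin k → Fin k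
_+ₖ_ {k} a b = (toℕ a ℕ.+ toℕ b) mod k
  where import Data.Nat.Base as ℕ

module Incidence (k : ℕ) .{{_ : NonZero k}} (n : ℕ) where

  Pt : Set
  Pt = Vec (Fin k) n

  _⊕_ : Pt → Pt → Pt
  _⊕_ = zipWith _+ₖ_

  1ₖ : Fin k
  1ₖ = 1 mod k

  o : Pt
  o = replicate n (0 mod k)

  -- the canonical set D_n = {e₀, e₁, …, eₙ}, indexed by Fin (n+1):
  -- index zero ↦ e₀ = o, index (suc i) ↦ e_{i+1} (1 in coordinate i+1)
  e : Fin (ℕ.suc n) → Pt
  e zero    = o
  e (suc i) = o [ i ]≔ 1ₖ
    where import Data.Nat.Base as ℕ

  -- Lines are the translates b + D_n, b ∈ (C_k)^n; the line b + D_n is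
  -- indexed by b.  Incidence is membership: x ∈ b + D_n.
  Line : Set
  Line = Pt

  _∈L_ : Pt → Line → Set
  x ∈L b = ∃ λ i → x ≡ b ⊕ e i

  record Aut : Set where
    field
      pt  : Pt ↔ Pt
      ln  : Line ↔ Line
      inc : ∀ x b → (x ∈L b) ⇔ (Inverse.to pt x ∈L Inverse.to ln b)

  open Aut public

  _·_ : Aut → Pt → Pt
  φ · x = Inverse.to (pt φ) x

  _·ₗ_ : Aut → Line → Line
  φ ·ₗ b = Inverse.to (ln φ) b

  _≈A_ : Aut → Aut → Set
  φ ≈A ψ = (∀ x → φ · x ≡ ψ · x) × (∀ b → φ ·ₗ b ≡ ψ ·ₗ b)

  idA : Aut
  idA = record { pt = ↔-id Pt ; ln = ↔-id Line ; inc = λ x b → ⇔-id _ }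

  _∘A_ : Aut → Aut → Aut
  φ ∘A ψ = record
    { pt  = pt φ ↔-∘ pt ψ
    ; ln  = ln φ ↔-∘ ln ψ
    ; inc = λ x b → inc φ (ψ · x) (ψ ·ₗ b) ⇔-∘ inc ψ x b
    }

  _⁻¹A : Aut → Aut
  φ ⁻¹A = record
    { pt  = ↔-sym (pt φ)
    ; ln  = ↔-sym (ln φ)
    ; inc = λ x b → ⇔-sym
        (subst₂ (λ y c → (Inverse.from (pt φ) x ∈L Inverse.from (ln φ) b) ⇔ (y ∈L c))
                (Inverse.strictlyInverseˡ (pt φ) x)
                (Inverse.strictlyInverseˡ (ln φ) b)
                (inc φ (Inverse.from (pt φ) x) (Inverse.from (ln φ) b)))
    }

  Stab : Set
  Stab = Σ Aut λ φ → φ · o ≡ o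

  _∘S_ : Stab → Stab → Stab
  (φ , eφ) ∘S (ψ , eψ) = (φ ∘A ψ) , trans (cong (φ ·_) eψ) eφ

  IsTranslation : Aut → Pt → Set
  IsTranslation φ v = ∀ x → φ · x ≡ x ⊕ v

  record StabIso (m : ℕ) : Set where
    field
      Φ      : Stab → Permutation′ m
      Φ-cong : ∀ (φ ψ : Stab) → proj₁ φ ≈A proj₁ ψ →
               ∀ i → Φ φ ⟨$⟩ʳ i ≡ Φ ψ ⟨$⟩ʳ i
      Φ-hom  : ∀ (φ ψ : Stab) →
               ∀ i → Φ (φ ∘S ψ) ⟨$⟩ʳ i ≡ Φ φ ⟨$⟩ʳ (Φ ψ ⟨$⟩ʳ i)
      Φ-inj  : ∀ (φ ψ : Stab) → (∀ i → Φ φ ⟨$⟩ʳ i ≡ Φ ψ ⟨$⟩ʳ i) →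
               proj₁ φ ≈A proj₁ ψ
      Φ-surj : ∀ (π : Permutation′ m) →
               Σ Stab λ φ → ∀ i → Φ φ ⟨$⟩ʳ i ≡ π ⟨$⟩ʳ i

  record SemidirectTranslationsStab : Set where
    field
      translation : ∀ v → Σ Aut λ τ → IsTranslation τ v
      normal      : ∀ (φ τ : Aut) v → IsTranslation τ v →
                    Σ Pt λ w → IsTranslation ((φ ∘A τ) ∘A (φ ⁻¹A)) w
      trivial-∩   : ∀ (τ : Aut) v → IsTranslation τ v → τ · o ≡ o →
                    τ ≈A idA
      product     : ∀ (φ : Aut) → Σ Aut λ τ → Σ Pt λ v → Σ Stab λ ψ →
                    IsTranslation τ v × (φ ≈A (τ ∘A proj₁ ψ))

module Submission where

-- Translations and the maps permuting the n+1 "homogeneous coordinates"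
-- (x ↦ (−Σx, x) ∈ (C_k)^{n+1}, under which e_a becomes ε_a − ε_0) are
-- automorphisms.  Conversely, the key fact is rigidity: an automorphism
-- fixing o and the n+1 lines through o is the identity.  Call a point
-- pinned if it and all lines through it are fixed; on a line through a
-- pinned point every point is fixed (otherwise a triangle would produce a
-- relation e_s + e_a + e_i = e_j + e_t + e_j, which is impossible because
-- for k ≥ 4 sums of at most three unit vectors determine the multiset of
-- summands), and from this pinnedness spreads from p to p + e_j, hence to all
-- of (C_k)^n.  Rigidity makes the action of the stabilizer of o on the lines
-- through o a faithful homomorphism onto S_{n+1}, and shows every
-- automorphism is affine, which gives the semidirect decomposition.

open import Defs
open import Data.Nat.Base as ℕ using (ℕ; NonZero; _<_; _≤_; suc; zero)
open import Data.Nat.DivMod using (_mod_; _%_; %-distribˡ-+; m<n⇒m%n≡m; n%n≡0)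
import Data.Nat.Properties as ℕₚ
import Data.Nat.ListAction as ℕList
open import Data.Fin.Base using (Fin; toℕ; zero; suc)
open import Data.Fin.Properties using (toℕ-injective; toℕ<n; toℕ-fromℕ<; _≟_; suc-injective)
open import Data.Fin.Permutation using (Permutation′; _⟨$⟩ʳ_; _⟨$⟩ˡ_; flip; inverseˡ; inverseʳ)
open import Data.Vec.Base using (Vec; []; _∷_; zipWith; replicate; map; lookup; _[_]≔_; tabulate)
import Data.Vec.Properties as Vecₚ
open import Data.List.Base as List using (List; []; _∷_; length)
open import Data.Product.Base using (_,_; Σ; _×_; proj₁; proj₂)
open import Data.Empty using (⊥; ⊥-elim)
open import Relation.Nullary using (yes; no)
open import Function.Base using (_∘_)
open import Function.Bundles using (Inverse; Equivalence; mk↔ₛ′; mk⇔)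
open import Algebra.Bundles using (AbelianGroup)
import Algebra.Properties.AbelianGroup as AbelianGroupProperties
import Algebra.Properties.CommutativeSemigroup as CommutativeSemigroupProperties
import Algebra.Properties.CommutativeMonoid.Sum as Sums
import Algebra.Solver.CommutativeMonoid as CommutativeMonoidSolver
open import Relation.Binary.PropositionalEquality

module CyclicGroup (k-1 : ℕ) where

  k : ℕ
  k = suc k-1

  G : Set
  G = Fin k

  infixl 6 _+g_
  _+g_ : G → G → G
  _+g_ = _+ₖ_

  ⟦_⟧ : ℕ → G
  ⟦ x ⟧ = x mod k

  0g 1g : G
  0g = ⟦ 0 ⟧
  1g = ⟦ 1 ⟧

  -g_ : G → G
  -g a = ⟦ k ℕ.∸ toℕ a ⟧

  toℕ-⟦⟧ : ∀ x → toℕ ⟦ x ⟧ ≡ x % k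
  toℕ-⟦⟧ x = toℕ-fromℕ< _

  ⟦⟧-toℕ : ∀ a → ⟦ toℕ a ⟧ ≡ a
  ⟦⟧-toℕ a = toℕ-injective (trans (toℕ-⟦⟧ (toℕ a)) (m<n⇒m%n≡m (toℕ<n a)))

  ⟦⟧-hom : ∀ x y → ⟦ x ⟧ +g ⟦ y ⟧ ≡ ⟦ x ℕ.+ y ⟧
  ⟦⟧-hom x y = toℕ-injective (begin
    toℕ (⟦ x ⟧ +g ⟦ y ⟧)                 ≡⟨ toℕ-⟦⟧ (toℕ ⟦ x ⟧ ℕ.+ toℕ ⟦ y ⟧) ⟩
    (toℕ ⟦ x ⟧ ℕ.+ toℕ ⟦ y ⟧) % k        ≡⟨ cong₂ (λ a b → (a ℕ.+ b) % k) (toℕ-⟦⟧ x) (toℕ-⟦⟧ y) ⟩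
    (x % k ℕ.+ y % k) % k                ≡⟨ %-distribˡ-+ x y k ⟨
    (x ℕ.+ y) % k                        ≡⟨ toℕ-⟦⟧ (x ℕ.+ y) ⟨
    toℕ ⟦ x ℕ.+ y ⟧                      ∎)
    where open ≡-Reasoning

  -- Every group law of C_k is transported from ℕ along the surjective
  -- homomorphism ⟦_⟧, writing each a : G as ⟦ toℕ a ⟧.
  +g-assoc : ∀ a b c → (a +g b) +g c ≡ a +g (b +g c)
  +g-assoc a b c = begin
    (a +g b) +g c                          ≡⟨ cong (a +g b +g_) (⟦⟧-toℕ c) ⟨
    ⟦ toℕ a ℕ.+ toℕ b ⟧ +g ⟦ toℕ c ⟧        ≡⟨ ⟦⟧-hom (toℕ a ℕ.+ toℕ b) (toℕ c) ⟩
    ⟦ toℕ a ℕ.+ toℕ b ℕ.+ toℕ c ⟧           ≡⟨ cong ⟦_⟧ (ℕₚ.+-assoc (toℕ a) (toℕ b) (toℕ c)) ⟩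
    ⟦ toℕ a ℕ.+ (toℕ b ℕ.+ toℕ c) ⟧         ≡⟨ ⟦⟧-hom (toℕ a) (toℕ b ℕ.+ toℕ c) ⟨
    ⟦ toℕ a ⟧ +g (b +g c)                  ≡⟨ cong (_+g (b +g c)) (⟦⟧-toℕ a) ⟩
    a +g (b +g c)                          ∎
    where open ≡-Reasoning

  +g-comm : ∀ a b → a +g b ≡ b +g a
  +g-comm a b = cong ⟦_⟧ (ℕₚ.+-comm (toℕ a) (toℕ b))

  +g-identityˡ : ∀ a → 0g +g a ≡ a
  +g-identityˡ a = ⟦⟧-toℕ a

  +g-identityʳ : ∀ a → a +g 0g ≡ a
  +g-identityʳ a = trans (+g-comm a 0g) (+g-identityˡ a)

  +g-inverseʳ : ∀ a → a +g (-g a) ≡ 0g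
  +g-inverseʳ a = begin
    a +g -g a                          ≡⟨ cong (_+g -g a) (⟦⟧-toℕ a) ⟨
    ⟦ toℕ a ⟧ +g ⟦ k ℕ.∸ toℕ a ⟧        ≡⟨ ⟦⟧-hom (toℕ a) (k ℕ.∸ toℕ a) ⟩
    ⟦ toℕ a ℕ.+ (k ℕ.∸ toℕ a) ⟧         ≡⟨ cong ⟦_⟧ (ℕₚ.m+[n∸m]≡n (ℕₚ.<⇒≤ (toℕ<n a))) ⟩
    ⟦ k ⟧                              ≡⟨ toℕ-injective (trans (toℕ-⟦⟧ k) (n%n≡0 k)) ⟩
    0g                                 ∎
    where open ≡-Reasoning

  +g-inverseˡ : ∀ a → (-g a) +g a ≡ 0g
  +g-inverseˡ a = trans (+g-comm (-g a) a) (+g-inverseʳ a)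

  Cₖ : AbelianGroup _ _
  Cₖ = record
    { isAbelianGroup = record
      { isGroup = record
        { isMonoid = record
          { isSemigroup = record
            { isMagma = record { isEquivalence = isEquivalence ; ∙-cong = cong₂ _+g_ }
            ; assoc = +g-assoc }
          ; identity = +g-identityˡ , +g-identityʳ }
        ; inverse = +g-inverseˡ , +g-inverseʳ
        ; ⁻¹-cong = cong -g_ }
      ; comm = +g-comm } }

  ⟦⟧-injective : ∀ {x y} → x < k → y < k → ⟦ x ⟧ ≡ ⟦ y ⟧ → x ≡ y
  ⟦⟧-injective {x} {y} x<k y<k eq = begin
    x             ≡⟨ m<n⇒m%n≡m x<k ⟨
    x % k         ≡⟨ toℕ-⟦⟧ x ⟨
    toℕ ⟦ x ⟧     ≡⟨ cong toℕ eq ⟩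
    toℕ ⟦ y ⟧     ≡⟨ toℕ-⟦⟧ y ⟩
    y % k         ≡⟨ m<n⇒m%n≡m y<k ⟩
    y             ∎
    where open ≡-Reasoning

module Vectors (k-1 : ℕ) where
  open CyclicGroup k-1

  infixl 6 _⊕_
  _⊕_ : ∀ {l} → Vec G l → Vec G l → Vec G l
  _⊕_ = zipWith _+g_

  zeroVec : ∀ l → Vec G l
  zeroVec l = replicate l 0g

  unit : ∀ {l} → Fin (suc l) → Vec G l
  unit {l} = Incidence.e k l

  Cₖ^ : ℕ → AbelianGroup _ _
  Cₖ^ l = record
    { Carrier = Vec G l
    ; _∙_ = _⊕_
    ; ε = zeroVec l
    ; _⁻¹ = map -g_
    ; isAbelianGroup = record
      { isGroup = record
        { isMonoid = record
          { isSemigroup = record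
            { isMagma = record { isEquivalence = isEquivalence ; ∙-cong = cong₂ _⊕_ }
            ; assoc = Vecₚ.zipWith-assoc +g-assoc }
          ; identity = Vecₚ.zipWith-identityˡ +g-identityˡ , Vecₚ.zipWith-identityʳ +g-identityʳ }
        ; inverse = Vecₚ.zipWith-inverseˡ +g-inverseˡ , Vecₚ.zipWith-inverseʳ +g-inverseʳ
        ; ⁻¹-cong = cong (map -g_) }
      ; comm = Vecₚ.zipWith-comm +g-comm } }

  unit-induction : ∀ {l} (P : Vec G l → Set) → P (zeroVec l) →
                   (∀ x j → P x → P (x ⊕ unit j)) → ∀ x → P x
  unit-induction P p₀ step [] = p₀
  unit-induction P p₀ step (a ∷ w) = subst (λ z → P (z ∷ w)) (⟦⟧-toℕ a) (multiple (toℕ a))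
    where
      -- the restriction of P to the hyperplane x₁ = 0 is again such a property
      on-hyperplane : ∀ v → P (0g ∷ v)
      on-hyperplane = unit-induction (λ v → P (0g ∷ v)) p₀ λ where
        v zero    p → step (0g ∷ v) zero p
        v (suc j) p → step (0g ∷ v) (suc (suc j)) p

      multiple : ∀ t → P (⟦ t ⟧ ∷ w)
      multiple zero    = on-hyperplane w
      multiple (suc t) = subst₂ (λ z v → P (z ∷ v))
        (trans (⟦⟧-hom t 1) (cong ⟦_⟧ (ℕₚ.+-comm t 1)))
        (Vecₚ.zipWith-identityʳ +g-identityʳ w)
        (step (⟦ t ⟧ ∷ w) (suc zero) (multiple t))

δ : ∀ {N} → Fin N → Fin N → ℕ
δ a j with a ≟ j
... | yes _ = 1
... | no  _ = 0

δ-self : ∀ {N} (a : Fin N) → δ a a ≡ 1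
δ-self a with a ≟ a
... | yes _  = refl
... | no a≢a = ⊥-elim (a≢a refl)

δ-other : ∀ {N} {a j : Fin N} → a ≢ j → δ a j ≡ 0
δ-other {a = a} {j} a≢j with a ≟ j
... | yes a≡j = ⊥-elim (a≢j a≡j)
... | no  _   = refl

δ≤1 : ∀ {N} (a j : Fin N) → δ a j ≤ 1
δ≤1 a j with a ≟ j
... | yes _ = ℕₚ.≤-refl
... | no  _ = ℕ.z≤n

δ-positive : ∀ {N} {a j : Fin N} → 0 < δ a j → a ≡ j
δ-positive {a = a} {j} pos with a ≟ j
... | yes a≡j = a≡j
δ-positive () | no _

δ-injective : ∀ {N M} (f : Fin N → Fin M) → (∀ {a b} → f a ≡ f b → a ≡ b) →
              ∀ a b → δ (f a) (f b) ≡ δ a b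
δ-injective f inj a b with a ≟ b
... | yes refl = δ-self (f a)
... | no  a≢b  = δ-other (a≢b ∘ inj)

-- Homogeneous coordinates.  (C_k)^n is identified with the zero-sum vectors
-- of (C_k)^{n+1} via x ↦ (−Σx, x).  Under this identification e_a becomes
-- ε_a − ε_0 for the standard basis ε of (C_k)^{n+1}; hence sums of elements
-- of D_n can be compared by counting multiplicities, and S_{n+1} acts on
-- (C_k)^n by permuting the n+1 homogeneous coordinates.
module Coordinates (k-1 n : ℕ) where
  open CyclicGroup k-1
  open Vectors k-1
  open Incidence k n using (Pt; o; e)
  open AbelianGroupProperties Cₖ using (ε⁻¹≈ε; ⁻¹-∙-comm; inverseˡ-unique)
  open CommutativeSemigroupProperties (AbelianGroup.commutativeSemigroup Cₖ) using (interchange)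
  open Sums (AbelianGroup.commutativeMonoid Cₖ) using (sum; sum-cong-≗; ∑-distrib-+; sum-permute; sum-replicate-zero)

  Idx : Set
  Idx = Fin (suc n)

  Homog : Set
  Homog = Idx → G

  toHomog : Pt → Homog
  toHomog x zero    = -g sum (lookup x)
  toHomog x (suc c) = lookup x c

  fromHomog : Homog → Pt
  fromHomog y = tabulate (y ∘ suc)

  fromHomog-cong : ∀ {y z : Homog} → (∀ j → y j ≡ z j) → fromHomog y ≡ fromHomog z
  fromHomog-cong y≗z = Vecₚ.tabulate-cong (y≗z ∘ suc)

  fromHomog-toHomog : ∀ x → fromHomog (toHomog x) ≡ x
  fromHomog-toHomog = Vecₚ.tabulate∘lookup

  sum-toHomog : ∀ x → sum (toHomog x) ≡ 0g
  sum-toHomog x = +g-inverseˡ (sum (lookup x))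

  toHomog-fromHomog : ∀ y → sum y ≡ 0g → ∀ j → toHomog (fromHomog y) j ≡ y j
  toHomog-fromHomog y Σy≡0 zero = begin
    -g sum (lookup (fromHomog y))    ≡⟨ cong -g_ (sum-cong-≗ (Vecₚ.lookup∘tabulate (y ∘ suc))) ⟩
    -g sum (y ∘ suc)             ≡⟨ inverseˡ-unique (y zero) _ Σy≡0 ⟨
    y zero                       ∎
    where open ≡-Reasoning
  toHomog-fromHomog y Σy≡0 (suc c) = Vecₚ.lookup∘tabulate (y ∘ suc) c

  toHomog-⊕ : ∀ x y j → toHomog (x ⊕ y) j ≡ toHomog x j +g toHomog y j
  toHomog-⊕ x y zero = begin
    -g sum (lookup (x ⊕ y))                     ≡⟨ cong -g_ (sum-cong-≗ (λ c → Vecₚ.lookup-zipWith _+g_ c x y)) ⟩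
    -g sum (λ c → lookup x c +g lookup y c)     ≡⟨ cong -g_ (∑-distrib-+ (lookup x) (lookup y)) ⟩
    -g (sum (lookup x) +g sum (lookup y))       ≡⟨ ⁻¹-∙-comm (sum (lookup x)) (sum (lookup y)) ⟨
    toHomog x zero +g toHomog y zero                    ∎
    where open ≡-Reasoning
  toHomog-⊕ x y (suc c) = Vecₚ.lookup-zipWith _+g_ c x y

  fromHomog-+ : ∀ y z → fromHomog (λ j → y j +g z j) ≡ fromHomog y ⊕ fromHomog z
  fromHomog-+ y z = trans (Vecₚ.tabulate-cong coordinates) (Vecₚ.tabulate∘lookup (fromHomog y ⊕ fromHomog z))
    where
      coordinates : ∀ c → y (suc c) +g z (suc c) ≡ lookup (fromHomog y ⊕ fromHomog z) c
      coordinates c = sym (trans (Vecₚ.lookup-zipWith _+g_ c (fromHomog y) (fromHomog z))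
        (cong₂ _+g_ (Vecₚ.lookup∘tabulate (y ∘ suc) c) (Vecₚ.lookup∘tabulate (z ∘ suc) c)))

  sum-zeroVec : ∀ l → sum (lookup (zeroVec l)) ≡ 0g
  sum-zeroVec l = trans (sum-cong-≗ {l} (λ c → Vecₚ.lookup-replicate c 0g)) (sum-replicate-zero l)

  sum-single : ∀ l (c : Fin l) x → sum (lookup (zeroVec l [ c ]≔ x)) ≡ x
  sum-single (suc l) zero    x = trans (cong (x +g_) (sum-zeroVec l)) (+g-identityʳ x)
  sum-single (suc l) (suc c) x = trans (+g-identityˡ _) (sum-single l c x)

  toHomog-o : ∀ j → toHomog o j ≡ 0g
  toHomog-o zero    = trans (cong -g_ (sum-zeroVec n)) ε⁻¹≈ε
  toHomog-o (suc c) = Vecₚ.lookup-replicate c 0g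

  ε : Idx → Homog
  ε a j = ⟦ δ a j ⟧

  ε-self : ∀ a → ε a a ≡ 1g
  ε-self a = cong ⟦_⟧ (δ-self a)

  ε-other : ∀ {a j} → a ≢ j → ε a j ≡ 0g
  ε-other a≢j = cong ⟦_⟧ (δ-other a≢j)

  lookup-unit : ∀ a c → lookup (e a) c ≡ ε a (suc c)
  lookup-unit zero    c = Vecₚ.lookup-replicate c 0g
  lookup-unit (suc i) c with i ≟ c
  ... | yes refl = Vecₚ.lookup∘update i o 1g
  ... | no  i≢c  = trans (Vecₚ.lookup∘update′ (i≢c ∘ sym) o 1g) (Vecₚ.lookup-replicate c 0g)

  unit-fromHomog : ∀ a → e a ≡ fromHomog (ε a)
  unit-fromHomog a = trans (sym (Vecₚ.tabulate∘lookup (e a))) (Vecₚ.tabulate-cong (lookup-unit a))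

  toHomog-unit : ∀ a j → toHomog (e a) j +g ε zero j ≡ ε a j
  toHomog-unit a (suc c) = trans (cong₂ _+g_ (lookup-unit a c) (ε-other {zero} {suc c} λ ()))
                             (+g-identityʳ (ε a (suc c)))
  toHomog-unit zero    zero = trans (cong (_+g ε zero zero) (toHomog-o zero)) (+g-identityˡ (ε zero zero))
  toHomog-unit (suc i) zero = begin
    -g sum (lookup (e (suc i))) +g ε zero zero   ≡⟨ cong₂ (λ s t → -g s +g t) (sum-single n i 1g) (ε-self zero) ⟩
    -g 1g +g 1g                                  ≡⟨ +g-inverseˡ 1g ⟩
    0g                                           ≡⟨ ε-other {suc i} {zero} (λ ()) ⟨
    ε (suc i) zero                               ∎
    where open ≡-Reasoning

  Perm : Set
  Perm = Permutation′ (suc n)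

  permutation-injective : ∀ (σ : Perm) {a b} → σ ⟨$⟩ʳ a ≡ σ ⟨$⟩ʳ b → a ≡ b
  permutation-injective σ {a} {b} eq = trans (sym (inverseˡ σ)) (trans (cong (σ ⟨$⟩ˡ_) eq) (inverseˡ σ))

  ε-permute : ∀ (σ : Perm) b j → ε b (σ ⟨$⟩ˡ j) ≡ ε (σ ⟨$⟩ʳ b) j
  ε-permute σ b j = cong ⟦_⟧ (trans (sym (δ-injective (σ ⟨$⟩ʳ_) (permutation-injective σ) b (σ ⟨$⟩ˡ j)))
                                   (cong (δ (σ ⟨$⟩ʳ b)) (inverseʳ σ)))

  permute : Perm → Pt → Pt
  permute σ x = fromHomog (λ j → toHomog x (σ ⟨$⟩ˡ j))

  permute-inverse : ∀ σ x → permute (flip σ) (permute σ x) ≡ x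
  permute-inverse σ x = begin
    fromHomog (λ j → toHomog (permute σ x) (σ ⟨$⟩ʳ j))  ≡⟨ fromHomog-cong (λ j → toHomog-fromHomog (λ i → toHomog x (σ ⟨$⟩ˡ i)) balanced (σ ⟨$⟩ʳ j)) ⟩
    fromHomog (λ j → toHomog x (σ ⟨$⟩ˡ (σ ⟨$⟩ʳ j)))     ≡⟨ fromHomog-cong (λ j → cong (toHomog x) (inverseˡ σ {j})) ⟩
    fromHomog (toHomog x)                              ≡⟨ fromHomog-toHomog x ⟩
    x                                                  ∎
    where
      open ≡-Reasoning
      balanced : sum (λ j → toHomog x (σ ⟨$⟩ˡ j)) ≡ 0g
      balanced = trans (sym (sum-permute (toHomog x) (flip σ))) (sum-toHomog x)

  permute-⊕ : ∀ σ x y → permute σ (x ⊕ y) ≡ permute σ x ⊕ permute σ y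
  permute-⊕ σ x y = trans (fromHomog-cong (λ j → toHomog-⊕ x y (σ ⟨$⟩ˡ j)))
                          (fromHomog-+ (λ j → toHomog x (σ ⟨$⟩ˡ j)) (λ j → toHomog y (σ ⟨$⟩ˡ j)))

  permute-o : ∀ σ → permute σ o ≡ o
  permute-o σ = begin
    fromHomog (λ j → toHomog o (σ ⟨$⟩ˡ j))  ≡⟨ fromHomog-cong (λ j → toHomog-o (σ ⟨$⟩ˡ j)) ⟩
    fromHomog (λ _ → 0g)                    ≡⟨ fromHomog-cong toHomog-o ⟨
    fromHomog (toHomog o)                   ≡⟨ fromHomog-toHomog o ⟩
    o                                       ∎
    where open ≡-Reasoning

  permute-unit : ∀ σ a → permute σ (e a) ⊕ e (σ ⟨$⟩ʳ zero) ≡ e (σ ⟨$⟩ʳ a)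
  permute-unit σ a = begin
    permute σ (e a) ⊕ e (σ ⟨$⟩ʳ zero)
      ≡⟨ cong (permute σ (e a) ⊕_) (unit-fromHomog (σ ⟨$⟩ʳ zero)) ⟩
    permute σ (e a) ⊕ fromHomog (ε (σ ⟨$⟩ʳ zero))
      ≡⟨ fromHomog-+ (λ j → toHomog (e a) (σ ⟨$⟩ˡ j)) (ε (σ ⟨$⟩ʳ zero)) ⟨
    fromHomog (λ j → toHomog (e a) (σ ⟨$⟩ˡ j) +g ε (σ ⟨$⟩ʳ zero) j)
      ≡⟨ fromHomog-cong (λ j → trans (cong (toHomog (e a) (σ ⟨$⟩ˡ j) +g_) (sym (ε-permute σ zero j)))
                                 (toHomog-unit a (σ ⟨$⟩ˡ j))) ⟩
    fromHomog (λ j → ε a (σ ⟨$⟩ˡ j))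
      ≡⟨ fromHomog-cong (ε-permute σ a) ⟩
    fromHomog (ε (σ ⟨$⟩ʳ a))
      ≡⟨ unit-fromHomog (σ ⟨$⟩ʳ a) ⟨
    e (σ ⟨$⟩ʳ a)
      ∎
    where open ≡-Reasoning

  mult : List Idx → Idx → ℕ
  mult A j = ℕList.sum (List.map (λ a → δ a j) A)

  unitSum : List Idx → Pt
  unitSum = List.foldr (λ a x → e a ⊕ x) o

  mult≤length : ∀ A j → mult A j ≤ length A
  mult≤length []      j = ℕ.z≤n
  mult≤length (a ∷ A) j = ℕₚ.+-mono-≤ (δ≤1 a j) (mult≤length A j)

  toHomog-unitSum : ∀ A j → toHomog (unitSum A) j +g ⟦ length A ℕ.* δ zero j ⟧ ≡ ⟦ mult A j ⟧
  toHomog-unitSum []      j = trans (cong (_+g 0g) (toHomog-o j)) (+g-identityˡ 0g)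
  toHomog-unitSum (a ∷ A) j = begin
    toHomog (e a ⊕ unitSum A) j +g ⟦ δ zero j ℕ.+ length A ℕ.* δ zero j ⟧
      ≡⟨ cong₂ _+g_ (toHomog-⊕ (e a) (unitSum A) j) (sym (⟦⟧-hom (δ zero j) (length A ℕ.* δ zero j))) ⟩
    (toHomog (e a) j +g toHomog (unitSum A) j) +g (ε zero j +g ⟦ length A ℕ.* δ zero j ⟧)
      ≡⟨ interchange (toHomog (e a) j) (toHomog (unitSum A) j) (ε zero j) _ ⟩
    (toHomog (e a) j +g ε zero j) +g (toHomog (unitSum A) j +g ⟦ length A ℕ.* δ zero j ⟧)
      ≡⟨ cong₂ _+g_ (toHomog-unit a j) (toHomog-unitSum A j) ⟩
    ε a j +g ⟦ mult A j ⟧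
      ≡⟨ ⟦⟧-hom (δ a j) (mult A j) ⟩
    ⟦ δ a j ℕ.+ mult A j ⟧
      ∎
    where open ≡-Reasoning

  -- For lists of equally many (fewer than k) indices, the sum of the
  -- corresponding unit vectors determines all multiplicities: D_n has no
  -- additive relations of small length beyond reordering.
  unitSum-injective : ∀ A B → length A ≡ length B → length A < k →
                      unitSum A ≡ unitSum B → ∀ j → mult A j ≡ mult B j
  unitSum-injective A B |A|≡|B| |A|<k sums≡ j =
    ⟦⟧-injective (ℕₚ.≤-<-trans (mult≤length A j) |A|<k)
                 (ℕₚ.≤-<-trans (mult≤length B j) (subst (_< k) |A|≡|B| |A|<k))
                 (begin
      ⟦ mult A j ⟧                                        ≡⟨ toHomog-unitSum A j ⟨
      toHomog (unitSum A) j +g ⟦ length A ℕ.* δ zero j ⟧  ≡⟨ cong₂ (λ x l → toHomog x j +g ⟦ l ℕ.* δ zero j ⟧) sums≡ |A|≡|B| ⟩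
      toHomog (unitSum B) j +g ⟦ length B ℕ.* δ zero j ⟧  ≡⟨ toHomog-unitSum B j ⟩
      ⟦ mult B j ⟧                                        ∎)
    where open ≡-Reasoning

module Geometry (m n-1 : ℕ) where
  k-1 : ℕ
  k-1 = suc (suc (suc m))

  n : ℕ
  n = suc n-1

  open CyclicGroup k-1 using (k)
  open Vectors k-1 using (Cₖ^; unit-induction)
  open Coordinates k-1 n
    using (Idx; Perm; permute; permute-inverse; permute-⊕; permute-o; permute-unit; mult; unitSum; unitSum-injective)
  open Incidence k n

  open AbelianGroup (Cₖ^ n) using () renaming (_⁻¹ to ⊖_; commutativeMonoid to Cₖⁿ)
  open AbelianGroup (Cₖ^ n) using (identityˡ; identityʳ) renaming (inverseˡ to ⊖-inverseˡ; inverseʳ to ⊖-inverseʳ)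
  open AbelianGroupProperties (Cₖ^ n) using (∙-cancelˡ; ∙-cancelʳ; x≈z//y; //-rightDividesˡ; //-rightDividesʳ; ⁻¹-injective)
  open CommutativeSemigroupProperties (AbelianGroup.commutativeSemigroup (Cₖ^ n)) using (xy∙z≈xz∙y)
  open CommutativeMonoidSolver Cₖⁿ using (solve; _⊜_) renaming (_⊕_ to _⊞_; id to ∅)

  infixl 6 _⊖_
  _⊖_ : Pt → Pt → Pt
  x ⊖ y = x ⊕ (⊖ y)

  counts : ∀ A B → length A ≡ length B → length A ≤ 3 →
           unitSum A ≡ unitSum B → ∀ j → mult A j ≡ mult B j
  counts A B |A|≡|B| |A|≤3 = unitSum-injective A B |A|≡|B| (ℕ.s≤s (ℕₚ.≤-trans |A|≤3 (ℕₚ.m≤m+n 3 m)))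

  unitSum-one : ∀ a → unitSum (a ∷ []) ≡ e a
  unitSum-one a = identityʳ (e a)

  unitSum-two : ∀ a b → unitSum (a ∷ b ∷ []) ≡ e a ⊕ e b
  unitSum-two a b = cong (e a ⊕_) (identityʳ (e b))

  unitSum-three : ∀ a b c → unitSum (a ∷ b ∷ c ∷ []) ≡ (e a ⊕ e b) ⊕ e c
  unitSum-three a b c =
    solve 3 (λ x y z → x ⊞ (y ⊞ (z ⊞ ∅)) ⊜ (x ⊞ y) ⊞ z) refl (e a) (e b) (e c)

  e-injective : ∀ {a b} → e a ≡ e b → a ≡ b
  e-injective {a} {b} ea≡eb = sym (δ-positive positive)
    where
      same : δ a a ℕ.+ 0 ≡ δ b a ℕ.+ 0
      same = counts (a ∷ []) (b ∷ []) refl (ℕ.s≤s ℕ.z≤n)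
                    (trans (unitSum-one a) (trans ea≡eb (sym (unitSum-one b)))) a
      positive : 0 < δ b a
      positive = begin-strict
        0             <⟨ ℕ.s≤s ℕ.z≤n ⟩
        1             ≡⟨ δ-self a ⟨
        δ a a         ≡⟨ ℕₚ.+-identityʳ (δ a a) ⟨
        δ a a ℕ.+ 0   ≡⟨ same ⟩
        δ b a ℕ.+ 0   ≡⟨ ℕₚ.+-identityʳ (δ b a) ⟩
        δ b a         ∎
        where open ℕₚ.≤-Reasoning

  two-units : ∀ {x y′ x′ y} → e x ⊕ e y′ ≡ e x′ ⊕ e y → x ≢ y → x ≡ x′
  two-units {x} {y′} {x′} {y} sums≡ x≢y = sym (δ-positive positive)
    where
      same : δ x x ℕ.+ (δ y′ x ℕ.+ 0) ≡ δ x′ x ℕ.+ (δ y x ℕ.+ 0)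
      same = counts (x ∷ y′ ∷ []) (x′ ∷ y ∷ []) refl (ℕ.s≤s (ℕ.s≤s ℕ.z≤n))
                    (trans (unitSum-two x y′) (trans sums≡ (sym (unitSum-two x′ y)))) x
      positive : 0 < δ x′ x
      positive = begin-strict
        0                              <⟨ ℕ.s≤s ℕ.z≤n ⟩
        1                              ≡⟨ δ-self x ⟨
        δ x x                          ≤⟨ ℕₚ.m≤m+n (δ x x) (δ y′ x ℕ.+ 0) ⟩
        δ x x ℕ.+ (δ y′ x ℕ.+ 0)       ≡⟨ same ⟩
        δ x′ x ℕ.+ (δ y x ℕ.+ 0)       ≡⟨ cong (λ d → δ x′ x ℕ.+ (d ℕ.+ 0)) (δ-other (x≢y ∘ sym)) ⟩
        δ x′ x ℕ.+ 0                   ≡⟨ ℕₚ.+-identityʳ (δ x′ x) ⟩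
        δ x′ x                         ∎
        where open ℕₚ.≤-Reasoning

  -- e_s + e_a + e_i = e_j + e_t + e_j is impossible when a ≠ j and i ≠ j:
  -- the index j occurs at most once on the left and at least twice on the right.
  three-units : ∀ {s a i j t} → (e s ⊕ e a) ⊕ e i ≡ (e j ⊕ e t) ⊕ e j → a ≢ j → i ≢ j → ⊥
  three-units {s} {a} {i} {j} {t} sums≡ a≢j i≢j = ℕₚ.1+n≰n (ℕₚ.≤-trans twice (subst (_≤ 1) same once))
    where
      same : δ s j ℕ.+ (δ a j ℕ.+ (δ i j ℕ.+ 0)) ≡ δ j j ℕ.+ (δ t j ℕ.+ (δ j j ℕ.+ 0))
      same = counts (s ∷ a ∷ i ∷ []) (j ∷ t ∷ j ∷ []) refl ℕₚ.≤-refl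
                    (trans (unitSum-three s a i) (trans sums≡ (sym (unitSum-three j t j)))) j
      once : δ s j ℕ.+ (δ a j ℕ.+ (δ i j ℕ.+ 0)) ≤ 1
      once = subst₂ (λ d d′ → δ s j ℕ.+ (d ℕ.+ (d′ ℕ.+ 0)) ≤ 1) (sym (δ-other a≢j)) (sym (δ-other i≢j))
                    (subst (_≤ 1) (sym (ℕₚ.+-identityʳ (δ s j))) (δ≤1 s j))
      twice : 2 ≤ δ j j ℕ.+ (δ t j ℕ.+ (δ j j ℕ.+ 0))
      twice = subst (λ d → 2 ≤ d ℕ.+ (δ t j ℕ.+ (d ℕ.+ 0))) (sym (δ-self j)) (ℕ.s≤s (ℕₚ.m≤n+m 1 (δ t j)))

  on-own-line : ∀ b → b ∈L b
  on-own-line b = zero , sym (identityʳ b)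

  base-point : ∀ {x b} → x ≡ b ⊕ e zero → x ≡ b
  base-point {x} {b} x≡ = trans x≡ (identityʳ b)

  line-via : ∀ x i → x ≡ (x ⊖ e i) ⊕ e i
  line-via x i = sym (//-rightDividesˡ (e i) x)

  exchange : ∀ {b p} u v → b ⊕ u ≡ p ⊕ v → b ≡ (p ⊖ u) ⊕ v
  exchange {b} {p} u v eq = trans (x≈z//y b u (p ⊕ v) eq) (xy∙z≈xz∙y p v (⊖ u))

  distinct-on-line : ∀ {b u v} → u ≢ v → b ⊕ e u ≢ b ⊕ e v
  distinct-on-line {b} {u} {v} u≢v eq = u≢v (e-injective {u} {v} (∙-cancelˡ b (e u) (e v) eq))

  common-line : ∀ {x y i j} → x ⊕ e i ≡ y ⊕ e j → x ∈L (x ⊖ e j) × y ∈L (x ⊖ e j)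
  common-line {x} {y} {i} {j} eq = (j , line-via x j) , (i , exchange (e j) (e i) (sym eq))

  unique-line : ∀ {x y b b′} → x ≢ y → x ∈L b → y ∈L b → x ∈L b′ → y ∈L b′ → b ≡ b′
  unique-line {b = b} {b′} x≢y (u , x≡) (v , y≡) (u′ , x≡′) (v′ , y≡′) =
    ∙-cancelʳ (e u) b b′ (trans (sym x≡) (trans x≡′ (cong (λ w → b′ ⊕ e w) (sym u≡u′))))
    where
      open ≡-Reasoning
      u≢v : u ≢ v
      u≢v refl = x≢y (trans x≡ (sym y≡))
      exchanged : e u ⊕ e v′ ≡ e u′ ⊕ e v
      exchanged = ∙-cancelˡ (b ⊕ b′) _ _ (begin
        (b ⊕ b′) ⊕ (e u ⊕ e v′)
          ≡⟨ solve 4 (λ p p′ w w′ → (p ⊞ p′) ⊞ (w ⊞ w′) ⊜ (p ⊞ w) ⊞ (p′ ⊞ w′)) refl b b′ (e u) (e v′) ⟩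
        (b ⊕ e u) ⊕ (b′ ⊕ e v′)
          ≡⟨ cong₂ _⊕_ (trans (sym x≡) x≡′) (trans (sym y≡′) y≡) ⟩
        (b′ ⊕ e u′) ⊕ (b ⊕ e v)
          ≡⟨ solve 4 (λ p p′ w w′ → (p′ ⊞ w) ⊞ (p ⊞ w′) ⊜ (p ⊞ p′) ⊞ (w ⊞ w′)) refl b b′ (e u′) (e v) ⟩
        (b ⊕ b′) ⊕ (e u′ ⊕ e v)
          ∎)
      u≡u′ : u ≡ u′
      u≡u′ = two-units {u} {v′} {u′} {v} exchanged u≢v

  -- Summing the vertices q, r, p of a triangle with sides c ∋ q, r;
  -- L ∋ r, p and b ∋ p, q in two ways yields a relation among unit vectors.
  triangle : ∀ {q r p c L b s a i s′ a′ i′} →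
             q ≡ c ⊕ e s → r ≡ L ⊕ e a → p ≡ b ⊕ e i →
             q ≡ b ⊕ e s′ → r ≡ c ⊕ e a′ → p ≡ L ⊕ e i′ →
             (e s ⊕ e a) ⊕ e i ≡ (e s′ ⊕ e a′) ⊕ e i′
  triangle {c = c} {L} {b} {s} {a} {i} {s′} {a′} {i′} q≡ r≡ p≡ q≡′ r≡′ p≡′ =
    ∙-cancelˡ ((c ⊕ L) ⊕ b) _ _ (begin
      ((c ⊕ L) ⊕ b) ⊕ ((e s ⊕ e a) ⊕ e i)
        ≡⟨ solve 6 (λ c′ L′ b′ x y z → ((c′ ⊞ L′) ⊞ b′) ⊞ ((x ⊞ y) ⊞ z) ⊜ ((c′ ⊞ x) ⊞ (L′ ⊞ y)) ⊞ (b′ ⊞ z))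
                   refl c L b (e s) (e a) (e i) ⟩
      ((c ⊕ e s) ⊕ (L ⊕ e a)) ⊕ (b ⊕ e i)
        ≡⟨ cong₂ _⊕_ (cong₂ _⊕_ (trans (sym q≡) q≡′) (trans (sym r≡) r≡′)) (trans (sym p≡) p≡′) ⟩
      ((b ⊕ e s′) ⊕ (c ⊕ e a′)) ⊕ (L ⊕ e i′)
        ≡⟨ solve 6 (λ c′ L′ b′ x y z → ((b′ ⊞ x) ⊞ (c′ ⊞ y)) ⊞ (L′ ⊞ z) ⊜ ((c′ ⊞ L′) ⊞ b′) ⊞ ((x ⊞ y) ⊞ z))
                   refl c L b (e s′) (e a′) (e i′) ⟩
      ((c ⊕ L) ⊕ b) ⊕ ((e s′ ⊕ e a′) ⊕ e i′)
        ∎)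
    where open ≡-Reasoning

  module Automorphism (φ : Aut) where
    f f⁻ : Pt → Pt
    f  = φ ·_
    f⁻ = Inverse.from (pt φ)

    g g⁻ : Line → Line
    g  = φ ·ₗ_
    g⁻ = Inverse.from (ln φ)

    f∘f⁻ : ∀ y → f (f⁻ y) ≡ y
    f∘f⁻ = Inverse.strictlyInverseˡ (pt φ)

    g∘g⁻ : ∀ c → g (g⁻ c) ≡ c
    g∘g⁻ = Inverse.strictlyInverseˡ (ln φ)

    g⁻∘g : ∀ b → g⁻ (g b) ≡ b
    g⁻∘g = Inverse.strictlyInverseʳ (ln φ)

    g-injective : ∀ {b b′} → g b ≡ g b′ → b ≡ b′
    g-injective {b} {b′} eq = trans (sym (g⁻∘g b)) (trans (cong g⁻ eq) (g⁻∘g b′))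

    maps : ∀ {x b} → x ∈L b → f x ∈L g b
    maps {x} {b} = Equivalence.to (inc φ x b)

    preimage-line : ∀ {x c} → f x ∈L c → x ∈L g⁻ c
    preimage-line {x} {c} fx∈c = Equivalence.from (inc φ x (g⁻ c)) (subst (f x ∈L_) (sym (g∘g⁻ c)) fx∈c)

    fixed-line-image : ∀ {x b} → g b ≡ b → x ∈L b → f x ∈L b
    fixed-line-image {x} gb≡b x∈b = subst (f x ∈L_) gb≡b (maps x∈b)

    fixed-line-preimage : ∀ {y b} → g b ≡ b → y ∈L b → f⁻ y ∈L b
    fixed-line-preimage {y} {b} gb≡b y∈b =
      subst (f⁻ y ∈L_) (trans (cong g⁻ (sym gb≡b)) (g⁻∘g b)) (preimage-line (subst (_∈L b) (sym (f∘f⁻ y)) y∈b))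

    fixed-points-fix-line : ∀ {x y b} → x ≢ y → x ∈L b → y ∈L b → f x ≡ x → f y ≡ y → g b ≡ b
    fixed-points-fix-line {x} {y} {b} x≢y x∈b y∈b fx≡x fy≡y =
      sym (unique-line x≢y x∈b y∈b (subst (_∈L g b) fx≡x (maps x∈b)) (subst (_∈L g b) fy≡y (maps y∈b)))

    Pinned : Pt → Set
    Pinned p = f p ≡ p × (∀ b → p ∈L b → g b ≡ b)

    -- On a line b through a pinned point p = b + e_i, φ cannot move a point
    -- q = b + e_j (j ≠ i) to another point b + e_j′ of b: otherwise, with
    -- L = p − e_j and r = L + e_j′, the points q, f⁻(r), p would form a
    -- triangle whose relation e_s + e_a + e_i = e_j + e_t + e_j is impossible.
    no-shift : ∀ {p b i j j′} → Pinned p → p ≡ b ⊕ e i → j ≢ i →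
               f (b ⊕ e j) ≡ b ⊕ e j′ → j′ ≢ j → ⊥
    no-shift {p} {b} {i} {j} {j′} (fp≡p , lines-fixed) p≡ j≢i fq≡ j′≢j =
      three-units {s} {a} {i} {j} {t} shape a≢j (j≢i ∘ sym)
      where
        open ≡-Reasoning
        q L r r′ : Pt
        q  = b ⊕ e j
        L  = p ⊖ e j
        r  = L ⊕ e j′
        r′ = f⁻ r

        p≡L : p ≡ L ⊕ e j
        p≡L = line-via p j

        -- r′ stays on the fixed line L through p
        r′-on-L : r′ ∈L L
        r′-on-L = fixed-line-preimage (lines-fixed L (j , p≡L)) (j′ , refl)

        a : Idx
        a = proj₁ r′-on-L

        r′≡ : r′ ≡ L ⊕ e a
        r′≡ = proj₂ r′-on-L

        a≢j : a ≢ j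
        a≢j a≡j = j′≢j (e-injective {j′} {j} (∙-cancelˡ L (e j′) (e j) (begin
          r          ≡⟨ f∘f⁻ r ⟨
          f r′       ≡⟨ cong f (trans r′≡ (trans (cong (λ w → L ⊕ e w) a≡j) (sym p≡L))) ⟩
          f p        ≡⟨ fp≡p ⟩
          p          ≡⟨ p≡L ⟩
          L ⊕ e j    ∎)))

        -- f q and r lie on a common line c, hence q and r′ lie on g⁻ c
        shared : f q ⊕ e i ≡ r ⊕ e j
        shared = begin
          f q ⊕ e i            ≡⟨ cong (_⊕ e i) fq≡ ⟩
          (b ⊕ e j′) ⊕ e i     ≡⟨ xy∙z≈xz∙y b (e j′) (e i) ⟩
          (b ⊕ e i) ⊕ e j′     ≡⟨ cong (_⊕ e j′) (trans (sym p≡) p≡L) ⟩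
          (L ⊕ e j) ⊕ e j′     ≡⟨ xy∙z≈xz∙y L (e j) (e j′) ⟩
          r ⊕ e j              ∎

        c : Line
        c = f q ⊖ e j

        on-c : f q ∈L c × r ∈L c
        on-c = common-line {f q} {r} {i} {j} shared

        q-on : q ∈L g⁻ c
        q-on = preimage-line (proj₁ on-c)

        r′-on : r′ ∈L g⁻ c
        r′-on = preimage-line (subst (_∈L c) (sym (f∘f⁻ r)) (proj₂ on-c))

        s t : Idx
        s = proj₁ q-on
        t = proj₁ r′-on

        shape : (e s ⊕ e a) ⊕ e i ≡ (e j ⊕ e t) ⊕ e j
        shape = triangle {s = s} {a} {i} {j} {t} {j} (proj₂ q-on) r′≡ p≡ refl (proj₂ r′-on) p≡L

    pinned-line-fixed : ∀ {p b i} → Pinned p → p ≡ b ⊕ e i → ∀ j → f (b ⊕ e j) ≡ b ⊕ e j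
    pinned-line-fixed {p} {b} {i} pin p≡ j with j ≟ i
    ... | yes refl = trans (cong f (sym p≡)) (trans (proj₁ pin) p≡)
    ... | no  j≢i  with fixed-line-image (proj₂ pin b (i , p≡)) (j , refl)
    ...   | j′ , fq≡ with j′ ≟ j
    ...     | yes refl = fq≡
    ...     | no  j′≢j = ⊥-elim (no-shift pin p≡ j≢i fq≡ j′≢j)

    -- If φ fixes q and every line b ∋ q with q = b + e_u, u ≠ 0, then φ also
    -- fixes the remaining line through q, since g permutes the lines through q.
    last-line : ∀ {q} → f q ≡ q → (∀ b u → q ≡ b ⊕ e u → u ≢ zero → g b ≡ b) →
                ∀ b → q ∈L b → g b ≡ b
    last-line {q} fq≡q others b (u , q≡) with u ≟ zero
    ... | no  u≢0 = others b u q≡ u≢0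
    ... | yes refl with maps {q} {b} (zero , q≡)
    ...   | w , fq≡ with w ≟ zero
    ...     | yes refl = trans (sym (base-point (trans (sym fq≡q) fq≡))) (base-point q≡)
    ...     | no  w≢0  = g-injective (others (g b) w (trans (sym fq≡q) fq≡) w≢0)

    pinned-step : ∀ p j → Pinned p → Pinned (p ⊕ e j)
    pinned-step p j pin with j ≟ zero
    ... | yes refl = subst Pinned (sym (identityʳ p)) pin
    ... | no  j≢0  = fq≡q , last-line fq≡q fixes-line
      where
        q : Pt
        q = p ⊕ e j

        fq≡q : f q ≡ q
        fq≡q = pinned-line-fixed {p} {p} {zero} pin (sym (identityʳ p)) j

        -- for q = b + e_u, the point b = (p − e_u) + e_j lies on the line p − e_u through p
        base-fixed : ∀ b u → q ≡ b ⊕ e u → f b ≡ b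
        base-fixed b u q≡ = subst (λ x → f x ≡ x) (sym (exchange (e u) (e j) (sym q≡)))
                                  (pinned-line-fixed {p} {p ⊖ e u} {u} pin (line-via p u) j)

        fixes-line : ∀ b u → q ≡ b ⊕ e u → u ≢ zero → g b ≡ b
        fixes-line b u q≡ u≢0 = fixed-points-fix-line q≢b (u , q≡) (on-own-line b) fq≡q (base-fixed b u q≡)
          where
            q≢b : q ≢ b
            q≢b q≡b = distinct-on-line u≢0 (trans (sym q≡) (trans q≡b (sym (identityʳ b))))

    rigid : Pinned o → (∀ x → f x ≡ x) × (∀ b → g b ≡ b)
    rigid pin-o = (λ x → proj₁ (pinned x)) , (λ b → proj₂ (pinned b) b (on-own-line b))
      where
        pinned : ∀ x → Pinned x
        pinned = unit-induction Pinned pin-o pinned-step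

    -- an automorphism fixing every point fixes every line (uses n ≥ 1)
    points-fix-lines : (∀ x → f x ≡ x) → ∀ b → g b ≡ b
    points-fix-lines fixes b =
      fixed-points-fix-line (distinct-on-line {b} {zero} {suc zero} λ ())
                            (zero , refl) (suc zero , refl) (fixes _) (fixes _)

  -- The automorphism induced by σ ∈ S_{n+1}: points move by `permute σ`, and
  -- since permute σ (e_i) = e_{σ(i)} − e_{σ(0)}, the line b moves to
  -- permute σ b − e_{σ(0)}.
  permuteLine : Perm → Line → Line
  permuteLine σ b = permute σ b ⊖ e (σ ⟨$⟩ʳ zero)

  permute-on-line : ∀ σ b i → permute σ (b ⊕ e i) ≡ permuteLine σ b ⊕ e (σ ⟨$⟩ʳ i)
  permute-on-line σ b i = begin
    permute σ (b ⊕ e i)                      ≡⟨ permute-⊕ σ b (e i) ⟩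
    permute σ b ⊕ permute σ (e i)            ≡⟨ cong (permute σ b ⊕_) (x≈z//y _ _ _ (permute-unit σ i)) ⟩
    permute σ b ⊕ (e (σ ⟨$⟩ʳ i) ⊖ e σ₀)      ≡⟨ solve 3 (λ x y z → x ⊞ (y ⊞ z) ⊜ (x ⊞ z) ⊞ y) refl (permute σ b) (e (σ ⟨$⟩ʳ i)) (⊖ e σ₀) ⟩
    permuteLine σ b ⊕ e (σ ⟨$⟩ʳ i)           ∎
    where
      open ≡-Reasoning
      σ₀ : Idx
      σ₀ = σ ⟨$⟩ʳ zero

  permuteLine-inverse : ∀ σ b → permuteLine (flip σ) (permuteLine σ b) ≡ b
  permuteLine-inverse σ b = begin
    permuteLine (flip σ) b′                                 ≡⟨ identityʳ _ ⟨
    permuteLine (flip σ) b′ ⊕ e zero                        ≡⟨ cong (λ w → permuteLine (flip σ) b′ ⊕ e w) (inverseˡ σ) ⟨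
    permuteLine (flip σ) b′ ⊕ e (σ ⟨$⟩ˡ (σ ⟨$⟩ʳ zero))      ≡⟨ permute-on-line (flip σ) b′ (σ ⟨$⟩ʳ zero) ⟨
    permute (flip σ) (b′ ⊕ e (σ ⟨$⟩ʳ zero))                 ≡⟨ cong (permute (flip σ)) (//-rightDividesˡ _ _) ⟩
    permute (flip σ) (permute σ b)                          ≡⟨ permute-inverse σ b ⟩
    b                                                       ∎
    where
      open ≡-Reasoning
      b′ : Line
      b′ = permuteLine σ b

  permutationAut : Perm → Aut
  permutationAut σ = record
    { pt  = mk↔ₛ′ (permute σ) (permute (flip σ)) (permute-inverse (flip σ)) (permute-inverse σ)
    ; ln  = mk↔ₛ′ (permuteLine σ) (permuteLine (flip σ)) (permuteLine-inverse (flip σ)) (permuteLine-inverse σ)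
    ; inc = λ x b → mk⇔ (forward x b) (backward x b)
    }
    where
      forward : ∀ x b → x ∈L b → permute σ x ∈L permuteLine σ b
      forward x b (i , x≡) = σ ⟨$⟩ʳ i , trans (cong (permute σ) x≡) (permute-on-line σ b i)

      backward : ∀ x b → permute σ x ∈L permuteLine σ b → x ∈L b
      backward x b (j , σx≡) = σ ⟨$⟩ˡ j , (begin
        x                                                   ≡⟨ permute-inverse σ x ⟨
        permute (flip σ) (permute σ x)                      ≡⟨ cong (permute (flip σ)) σx≡ ⟩
        permute (flip σ) (permuteLine σ b ⊕ e j)            ≡⟨ permute-on-line (flip σ) (permuteLine σ b) j ⟩
        permuteLine (flip σ) (permuteLine σ b) ⊕ e (σ ⟨$⟩ˡ j) ≡⟨ cong (_⊕ e (σ ⟨$⟩ˡ j)) (permuteLine-inverse σ b) ⟩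
        b ⊕ e (σ ⟨$⟩ˡ j)                                    ∎)
        where open ≡-Reasoning

  translationAut : Pt → Aut
  translationAut v = record
    { pt  = mk↔ₛ′ (_⊕ v) (_⊖ v) (//-rightDividesˡ v) (//-rightDividesʳ v)
    ; ln  = mk↔ₛ′ (_⊕ v) (_⊖ v) (//-rightDividesˡ v) (//-rightDividesʳ v)
    ; inc = λ x b → mk⇔
        (λ (i , x≡) → i , trans (cong (_⊕ v) x≡) (xy∙z≈xz∙y b (e i) v))
        (λ (i , x+v≡) → i , ∙-cancelʳ v x (b ⊕ e i) (trans x+v≡ (xy∙z≈xz∙y b v (e i))))
    }

  through-o : ∀ {b} j → o ≡ b ⊕ e j → b ≡ ⊖ e j
  through-o {b} j o≡ = trans (x≈z//y b (e j) o (sym o≡)) (identityˡ (⊖ e j))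

  o-on : ∀ j → o ∈L (⊖ e j)
  o-on j = j , sym (⊖-inverseˡ (e j))

  ⊖e-injective : ∀ {j j′} → ⊖ e j ≡ ⊖ e j′ → j ≡ j′
  ⊖e-injective {j} {j′} eq = e-injective {j} {j′} (⁻¹-injective eq)

  module LineAction (φ : Stab) where
    open Automorphism (proj₁ φ) public

    image-through-o : ∀ j → o ∈L g (⊖ e j)
    image-through-o j = subst (_∈L g (⊖ e j)) (proj₂ φ) (maps (o-on j))

    index : Idx → Idx
    index j = proj₁ (image-through-o j)

    index-spec : ∀ j → g (⊖ e j) ≡ ⊖ e (index j)
    index-spec j = through-o (index j) (proj₂ (image-through-o j))

    index-unique : ∀ j j′ → g (⊖ e j) ≡ ⊖ e j′ → index j ≡ j′
    index-unique j j′ eq = ⊖e-injective (trans (sym (index-spec j)) eq)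

  stabInverse : Stab → Stab
  stabInverse (φ , φo≡o) = φ ⁻¹A , trans (cong (Inverse.from (pt φ)) (sym φo≡o)) (Inverse.strictlyInverseʳ (pt φ) o)

  lineAction : Stab → Perm
  lineAction φ = mk↔ₛ′ A.index B.index A∘B B∘A
    where
      module A = LineAction φ
      module B = LineAction (stabInverse φ)
      A∘B : ∀ j → A.index (B.index j) ≡ j
      A∘B j = A.index-unique (B.index j) j (trans (cong A.g (sym (B.index-spec j))) (A.g∘g⁻ (⊖ e j)))
      B∘A : ∀ j → B.index (A.index j) ≡ j
      B∘A j = B.index-unique (A.index j) j (trans (cong A.g⁻ (sym (A.index-spec j))) (A.g⁻∘g (⊖ e j)))

  -- by rigidity, an element of the stabilizer is determined by its line action
  lineAction-injective : ∀ (φ ψ : Stab) → (∀ j → lineAction φ ⟨$⟩ʳ j ≡ lineAction ψ ⟨$⟩ʳ j) →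
                         proj₁ φ ≈A proj₁ ψ
  lineAction-injective φ ψ same = (λ x → undo (A.f x) (proj₁ identity x)) , (λ b → undo-line (A.g b) (proj₂ identity b))
    where
      module A = LineAction φ
      module B = LineAction ψ
      module C = Automorphism ((proj₁ ψ ⁻¹A) ∘A proj₁ φ)

      undo : ∀ y {x} → B.f⁻ y ≡ x → y ≡ B.f x
      undo y refl = sym (B.f∘f⁻ y)

      undo-line : ∀ c {b} → B.g⁻ c ≡ b → c ≡ B.g b
      undo-line c refl = sym (B.g∘g⁻ c)

      fixes-lines-through-o : ∀ b → o ∈L b → C.g b ≡ b
      fixes-lines-through-o b (j , o≡) = subst (λ c → C.g c ≡ c) (sym (through-o j o≡)) (begin
        B.g⁻ (A.g (⊖ e j))            ≡⟨ cong B.g⁻ (A.index-spec j) ⟩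
        B.g⁻ (⊖ e (A.index j))        ≡⟨ cong (λ i → B.g⁻ (⊖ e i)) (same j) ⟩
        B.g⁻ (⊖ e (B.index j))        ≡⟨ cong B.g⁻ (B.index-spec j) ⟨
        B.g⁻ (B.g (⊖ e j))            ≡⟨ B.g⁻∘g (⊖ e j) ⟩
        ⊖ e j                         ∎)
        where open ≡-Reasoning

      pinned-o : C.Pinned o
      pinned-o = trans (cong B.f⁻ (proj₂ φ)) (proj₂ (stabInverse ψ)) , fixes-lines-through-o

      identity : (∀ x → C.f x ≡ x) × (∀ b → C.g b ≡ b)
      identity = C.rigid pinned-o

  permutationStab : Perm → Stab
  permutationStab σ = permutationAut σ , permute-o σ

  lineAction-surjective : ∀ σ j → lineAction (permutationStab σ) ⟨$⟩ʳ j ≡ σ ⟨$⟩ʳ j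
  lineAction-surjective σ j = LineAction.index-unique (permutationStab σ) j (σ ⟨$⟩ʳ j) (through-o (σ ⟨$⟩ʳ j) (begin
    o                                              ≡⟨ permute-o σ ⟨
    permute σ o                                    ≡⟨ cong (permute σ) (⊖-inverseˡ (e j)) ⟨
    permute σ ((⊖ e j) ⊕ e j)                      ≡⟨ permute-on-line σ (⊖ e j) j ⟩
    permuteLine σ (⊖ e j) ⊕ e (σ ⟨$⟩ʳ j)           ∎))
    where open ≡-Reasoning

  lineAction-cong : ∀ (φ ψ : Stab) → proj₁ φ ≈A proj₁ ψ →
                    ∀ j → lineAction φ ⟨$⟩ʳ j ≡ lineAction ψ ⟨$⟩ʳ j
  lineAction-cong φ ψ φ≈ψ j =
    sym (LineAction.index-unique ψ j _ (trans (sym (proj₂ φ≈ψ (⊖ e j))) (LineAction.index-spec φ j)))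

  lineAction-hom : ∀ (φ ψ : Stab) →
                   ∀ j → lineAction (φ ∘S ψ) ⟨$⟩ʳ j ≡ lineAction φ ⟨$⟩ʳ (lineAction ψ ⟨$⟩ʳ j)
  lineAction-hom φ ψ j = LineAction.index-unique (φ ∘S ψ) j _
    (trans (cong (LineAction.g φ) (LineAction.index-spec ψ j)) (LineAction.index-spec φ (LineAction.index ψ j)))

  stabilizer≅S : StabIso (suc n)
  stabilizer≅S = record
    { Φ      = lineAction
    ; Φ-cong = lineAction-cong
    ; Φ-hom  = lineAction-hom
    ; Φ-inj  = lineAction-injective
    ; Φ-surj = λ σ → permutationStab σ , lineAction-surjective σ
    }

  stabPart : Aut → Stab
  stabPart φ = translationAut (⊖ (φ · o)) ∘A φ , ⊖-inverseʳ (φ · o)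

  affine : ∀ φ → Σ Perm λ σ → ∀ x → φ · x ≡ permute σ x ⊕ (φ · o)
  affine φ = σ , λ x → trans (sym (//-rightDividesˡ (φ · o) (φ · x))) (cong (_⊕ (φ · o)) (sym (proj₁ agree x)))
    where
      σ : Perm
      σ = lineAction (stabPart φ)
      agree : permutationAut σ ≈A proj₁ (stabPart φ)
      agree = lineAction-injective (permutationStab σ) (stabPart φ) (lineAction-surjective σ)

  conjugate-translation : ∀ φ τ v → IsTranslation τ v →
                          IsTranslation ((φ ∘A τ) ∘A (φ ⁻¹A)) (permute (proj₁ (affine φ)) v)
  conjugate-translation φ τ v τ≡ x = begin
    φ · (τ · y)                                ≡⟨ cong (φ ·_) (τ≡ y) ⟩
    φ · (y ⊕ v)                                ≡⟨ proj₂ (affine φ) (y ⊕ v) ⟩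
    permute σ (y ⊕ v) ⊕ (φ · o)                  ≡⟨ cong (_⊕ (φ · o)) (permute-⊕ σ y v) ⟩
    (permute σ y ⊕ permute σ v) ⊕ (φ · o)        ≡⟨ xy∙z≈xz∙y (permute σ y) (permute σ v) (φ · o) ⟩
    (permute σ y ⊕ (φ · o)) ⊕ permute σ v        ≡⟨ cong (_⊕ permute σ v) (proj₂ (affine φ) y) ⟨
    (φ · y) ⊕ permute σ v                        ≡⟨ cong (_⊕ permute σ v) (Inverse.strictlyInverseˡ (pt φ) x) ⟩
    x ⊕ permute σ v                            ∎
    where
      open ≡-Reasoning
      y : Pt
      y = Inverse.from (pt φ) x
      σ : Perm
      σ = proj₁ (affine φ)

  translation-fixing-o : ∀ τ v → IsTranslation τ v → τ · o ≡ o → τ ≈A idA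
  translation-fixing-o τ v τ≡ τo≡o = fixes , Automorphism.points-fix-lines τ fixes
    where
      v≡o : v ≡ o
      v≡o = trans (sym (identityˡ v)) (trans (sym (τ≡ o)) τo≡o)
      fixes : ∀ x → τ · x ≡ x
      fixes x = trans (τ≡ x) (trans (cong (x ⊕_) v≡o) (identityʳ x))

  semidirect : SemidirectTranslationsStab
  semidirect = record
    { translation = λ v → translationAut v , λ x → refl
    ; normal      = λ φ τ v τ≡ → permute (proj₁ (affine φ)) v , conjugate-translation φ τ v τ≡
    ; trivial-∩   = translation-fixing-o
    ; product     = λ φ → translationAut (φ · o) , φ · o , stabPart φ , (λ x → refl)
                        , (λ x → sym (//-rightDividesˡ (φ · o) (φ · x)))
                        , (λ b → sym (//-rightDividesˡ (φ · o) (φ ·ₗ b)))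
    }

proposition3p10 : (k : ℕ) .{{_ : NonZero k}} → 3 < k → (n : ℕ) → 1 ≤ n →
    Incidence.StabIso k n (suc n) × Incidence.SemidirectTranslationsStab k n
proposition3p10 (suc (suc (suc (suc m)))) (ℕ.s≤s (ℕ.s≤s (ℕ.s≤s (ℕ.s≤s _)))) (suc n-1) (ℕ.s≤s _) =
  Geometry.stabilizer≅S m n-1 , Geometry.semidirect m n-1
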